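{- Let $p$ be an odd prime. Then for each $n\in\mathbb{N}$, $$H_{p-1}(n)\equiv\begin{cases}1,& n\not\equiv-1\pmod p,\\ 2,& n\equiv -1\pmod p,\end{cases}\pmod p;$$ in particular $\nu_p(H_{p-1}(n))=0$ for all $n\in\mathbb{N}$. If moreover $p>3$, then for each $n\in\mathbb{N}$, $$H_{p-2}(n)\equiv\begin{cases}1,& n\not\equiv-1,-2\pmod p,\\ \frac{p+1}{2},& n\equiv-2\pmod p,\\ \frac{p+3}{2},& n\equiv-1\pmod p,\end{cases}\pmod p;$$ in particular $\nu_p(H_{p-2}(n))=0$ for all $n\in\mathbb{N}$.
   Context: $\mathbb{N}$ denotes the non-negative integers; $\nu_p$ is the $p$-adic valuation. For an integer $d\geq2$ and $n\in\mathbb{N}$, $H_d(n)$ is the number of permutations in $S_n$ that are products of pairwise disjoint $d$-cycles (identity included); equivalently $H_d(n)=1$ for $0\le n\le d-1$ and $H_d(n)=H_d(n-1)+(n-1)(n-2)\cdots(n-d+1)H_d(n-d)$ for $n\ge d$. -}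

module Defs where

open import Data.Nat using (ℕ; zero; suc; _+_; _*_; _∸_; _<ᵇ_)
open import Data.Bool using (if_then_else_)

fall : ℕ → ℕ → ℕ
fall m zero    = 1
fall m (suc k) = m * fall (m ∸ 1) k

-- Hrec fuel d n : the recurrence, evaluated with fuel (fuel ≥ n suffices)
Hrec : ℕ → ℕ → ℕ → ℕ
Hrec zero       d n = 1
Hrec (suc fuel) d n =
  if n <ᵇ d then 1
  else Hrec fuel d (n ∸ 1) + fall (n ∸ 1) (d ∸ 1) * Hrec fuel d (n ∸ d)

-- H d n = 1 for 0 ≤ n ≤ d-1,
-- H d n = H d (n-1) + (n-1)(n-2)...(n-d+1) H d (n-d) for n ≥ d
H : ℕ → ℕ → ℕ
H d n = Hrec n d n

-- Reduced mod p, the falling factorial m (m-1) ... (m-d+1) depends only on m mod p and vanishes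
-- when m mod p < d. So H_{d+1}(n) mod p is a function of n mod p, computed by a recurrence on
-- residues whose only nonzero coefficients are those at the residues d, ..., p-1. For d + 1 = p-1
-- these are (p-2)! = 1 and (p-1)! = -1, and for d + 1 = p-2 they are (p-3)! = -1/2, (p-2)! = 1
-- and (p-1)!/2 = -1/2 (mod p), by Wilson's theorem; a strong induction on n confirms the claimed
-- residues. Wilson's theorem itself comes from pairing each of 2, ..., p-2 with its inverse mod p,
-- which is again in that range and distinct from it.
module Submission where

open import Defs
open import Data.Nat using (ℕ; NonZero; _+_; _∸_; _>_; _%_; _/_)
open import Data.Nat.Primality using (Prime)
open import Data.Nat.Divisibility using (_∣_)
open import Data.Product using (_×_)
open import Relation.Nullary using (¬_)
open import Relation.Binary.PropositionalEquality using (_≡_; _≢_)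

open import Data.Bool using (true; false; T)
open import Data.Empty using (⊥-elim)
open import Data.List using (List; []; _∷_; _++_; length; map; downFrom)
open import Data.List.Membership.Propositional using (_∈_)
open import Data.List.Membership.Propositional.Properties
  using (∈-∃++; ∈-map⁺; ∈-map⁻; ∈-downFrom⁺; ∈-downFrom⁻)
open import Data.List.Relation.Binary.Permutation.Propositional using (_↭_; prep; ↭-sym; ↭⇒↭ₛ)
open import Data.List.Relation.Binary.Permutation.Propositional.Properties
  using (∈-resp-↭; All-resp-↭; shift; ↭-length)
open import Data.List.Relation.Unary.All as All using (All; _∷_)
open import Data.List.Relation.Unary.AllPairs using (_∷_)
open import Data.List.Relation.Unary.Any using (here; there)
open import Data.List.Relation.Unary.Unique.Propositional using (Unique)
import Data.List.Relation.Unary.Unique.Propositional.Properties as Unique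
open import Data.Nat
  using (zero; suc; _*_; _≤_; _<_; _<ᵇ_; _≤?_; _<?_; z≤n; s≤s; s≤s⁻¹; _!; >-nonZero; >-nonZero⁻¹)
open import Data.Nat.Coprimality using (coprime-Bézout; prime⇒coprime)
open import Data.Nat.Divisibility using (n∣m⇒m%n≡0; m%n≡0⇒n∣m; ∣⇒≤)
open import Data.Nat.DivMod
  using ( m≡m%n+[m/n]*n; m*n/n≡m; m<n*o⇒m/o<n; n%n≡0; m%n≤m; m%n<n; m<n⇒m%n≡m; m%n%n≡m%n
        ; m*n%n≡0; [m+n]%n≡m%n; %-distribˡ-+; %-distribˡ-*)
open import Data.Nat.GCD using (module Bézout)
open import Data.Nat.Induction using (<-rec)
open import Data.Nat.ListAction using (product)
open import Data.Nat.ListAction.Properties using (product-↭)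
open import Data.Nat.Primality
  using (euclidsLemma; prime⇒irreducible; ¬prime[0]; ¬prime[1]; composite[4]; composite⇒¬prime)
open import Data.Nat.Properties
open import Data.Nat.Tactic.RingSolver using (solve-∀)
open import Data.Product using (_,_; ∃-syntax)
open import Data.Sum using (_⊎_; inj₁; inj₂)
open import Function using (case_of_)
open import Level using (0ℓ)
open import Relation.Binary.Bundles using (Setoid)
open import Relation.Binary.PropositionalEquality
  using (refl; sym; trans; cong; cong₂; subst; subst₂; setoid; module ≡-Reasoning)
import Relation.Binary.Reasoning.Setoid as SetoidReasoning
open import Relation.Nullary using (yes; no)
open import Data.List.Relation.Binary.Permutation.Setoid.Properties (setoid ℕ) using (Unique-resp-↭)

Hrec-fuel-irrelevant : ∀ f g d n → n ≤ f → n ≤ g → Hrec f (suc d) n ≡ Hrec g (suc d) n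
Hrec-fuel-irrelevant zero    zero    d n     _   _   = refl
Hrec-fuel-irrelevant zero    (suc g) d .zero z≤n _   = refl
Hrec-fuel-irrelevant (suc f) zero    d .zero _   z≤n = refl
Hrec-fuel-irrelevant (suc f) (suc g) d n     n≤f n≤g with n <ᵇ suc d
... | true  = refl
... | false = cong₂ (λ x y → x + fall (n ∸ 1) d * y)
                    (Hrec-fuel-irrelevant f g d (n ∸ 1) (∸-monoˡ-≤ 1 n≤f) (∸-monoˡ-≤ 1 n≤g))
                    (Hrec-fuel-irrelevant f g d (n ∸ suc d) (shrink n≤f) (shrink n≤g))
  where
  shrink : ∀ {k} → n ≤ suc k → n ∸ suc d ≤ k
  shrink n≤k = ≤-trans (∸-monoʳ-≤ n (s≤s z≤n)) (∸-monoˡ-≤ 1 n≤k)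

H-below : ∀ d n → n < suc d → H (suc d) n ≡ 1
H-below d zero    _   = refl
H-below d (suc m) n<d with suc m <ᵇ suc d | <⇒<ᵇ n<d
... | true | _ = refl

H-step : ∀ d m → d ≤ m → H (suc d) (suc m) ≡ H (suc d) m + fall m d * H (suc d) (m ∸ d)
H-step d m d≤m with suc m <ᵇ suc d in eq
... | true  = ⊥-elim (<⇒≱ (<ᵇ⇒< (suc m) (suc d) (subst T (sym eq) _)) (s≤s d≤m))
... | false = cong (λ x → H (suc d) m + fall m d * x)
                   (Hrec-fuel-irrelevant m (m ∸ d) d (m ∸ d) (m∸n≤m m d) ≤-refl)

fall-< : ∀ {m k} → m < k → fall m k ≡ 0
fall-< {zero}  {suc k} _         = refl
fall-< {suc m} {suc k} (s≤s m<k) = trans (cong (suc m *_) (fall-< m<k)) (*-zeroʳ (suc m))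

fall[k+n]n*k!≡[k+n]! : ∀ k n → fall (k + n) n * k ! ≡ (k + n) !
fall[k+n]n*k!≡[k+n]! k zero    = trans (+-identityʳ (k !)) (cong _! (sym (+-identityʳ k)))
fall[k+n]n*k!≡[k+n]! k (suc n) rewrite +-suc k n =
  trans (*-assoc (suc (k + n)) (fall (k + n) n) (k !))
        (cong (suc (k + n) *_) (fall[k+n]n*k!≡[k+n]! k n))

product-map-2+-downFrom : ∀ k → product (map (2 +_) (downFrom k)) ≡ suc k !
product-map-2+-downFrom zero    = refl
product-map-2+-downFrom (suc k) = cong ((2 + k) *_) (product-map-2+-downFrom k)

module Modular (p : ℕ) .{{_ : NonZero p}} where

  -- A record rather than a function into _≡_, so that a and b can be inferred from a ≈ b.
  infix 4 _≈_
  record _≈_ (a b : ℕ) : Set where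
    constructor mod
    field mod-≡ : a % p ≡ b % p
  open _≈_ public

  ≈-refl : ∀ {a} → a ≈ a
  ≈-refl = mod refl

  ≈-sym : ∀ {a b} → a ≈ b → b ≈ a
  ≈-sym (mod e) = mod (sym e)

  ≈-trans : ∀ {a b c} → a ≈ b → b ≈ c → a ≈ c
  ≈-trans (mod e) (mod f) = mod (trans e f)

  ≈-setoid : Setoid 0ℓ 0ℓ
  ≈-setoid = record
    { _≈_           = _≈_
    ; isEquivalence = record { refl = ≈-refl ; sym = ≈-sym ; trans = ≈-trans }
    }

  module ≈-Reasoning = SetoidReasoning ≈-setoid

  ≡⇒≈ : ∀ {a b} → a ≡ b → a ≈ b
  ≡⇒≈ refl = ≈-refl

  +-cong : ∀ {a b c d} → a ≈ b → c ≈ d → a + c ≈ b + d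
  +-cong {a} {b} {c} {d} (mod e) (mod f) = mod (begin
    (a + c) % p           ≡⟨ %-distribˡ-+ a c p ⟩
    (a % p + c % p) % p   ≡⟨ cong₂ (λ x y → (x + y) % p) e f ⟩
    (b % p + d % p) % p   ≡⟨ %-distribˡ-+ b d p ⟨
    (b + d) % p           ∎)
    where open ≡-Reasoning

  *-cong : ∀ {a b c d} → a ≈ b → c ≈ d → a * c ≈ b * d
  *-cong {a} {b} {c} {d} (mod e) (mod f) = mod (begin
    (a * c) % p             ≡⟨ %-distribˡ-* a c p ⟩
    (a % p * (c % p)) % p   ≡⟨ cong₂ (λ x y → (x * y) % p) e f ⟩
    (b % p * (d % p)) % p   ≡⟨ %-distribˡ-* b d p ⟨
    (b * d) % p             ∎)
    where open ≡-Reasoning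

  +-congˡ : ∀ a {b c} → b ≈ c → a + b ≈ a + c
  +-congˡ a = +-cong (≈-refl {a})

  *-congˡ : ∀ a {b c} → b ≈ c → a * b ≈ a * c
  *-congˡ a = *-cong (≈-refl {a})

  m%p≈m : ∀ m → m % p ≈ m
  m%p≈m m = mod (m%n%n≡m%n m p)

  m+p≈m : ∀ m → m + p ≈ m
  m+p≈m m = mod ([m+n]%n≡m%n m p)

  n*p≈0 : ∀ n → n * p ≈ 0
  n*p≈0 n = mod (trans (m*n%n≡0 n p) (sym (m<n⇒m%n≡m (>-nonZero⁻¹ p))))

  ≈⇒≡ : ∀ {a b} → a < p → b < p → a ≈ b → a ≡ b
  ≈⇒≡ a<p b<p (mod e) = trans (sym (m<n⇒m%n≡m a<p)) (trans e (m<n⇒m%n≡m b<p))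

  ∣⇒≈0 : ∀ {a} → p ∣ a → a ≈ 0
  ∣⇒≈0 {a} p∣a = mod (trans (n∣m⇒m%n≡0 a p p∣a) (sym (m<n⇒m%n≡m (>-nonZero⁻¹ p))))

  ≈0⇒∣ : ∀ {a} → a ≈ 0 → p ∣ a
  ≈0⇒∣ {a} (mod e) = m%n≡0⇒n∣m a p (trans e (m<n⇒m%n≡m (>-nonZero⁻¹ p)))

  ∤-between : ∀ {v} → 0 < v → v < p → ¬ p ∣ v
  ∤-between 0<v v<p p∣v = <⇒≱ v<p (∣⇒≤ {{>-nonZero 0<v}} p∣v)

  ≈-between⇒∤ : ∀ {x v} → x ≈ v → 0 < v × v < p → ¬ p ∣ x
  ≈-between⇒∤ x≈v (0<v , v<p) p∣x = ∤-between 0<v v<p (≈0⇒∣ (≈-trans (≈-sym x≈v) (∣⇒≈0 p∣x)))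

  [p∸1]*a+a≈0 : ∀ a → (p ∸ 1) * a + a ≈ 0
  [p∸1]*a+a≈0 a = ≈-trans (≡⇒≈ (begin
    (p ∸ 1) * a + a     ≡⟨ +-comm ((p ∸ 1) * a) a ⟩
    (1 + (p ∸ 1)) * a   ≡⟨ cong (_* a) (m+[n∸m]≡n (>-nonZero⁻¹ p)) ⟩
    p * a               ≡⟨ *-comm p a ⟩
    a * p               ∎)) (n*p≈0 a)
    where open ≡-Reasoning

  +-cancelˡ : ∀ a {x y} → a + x ≈ a + y → x ≈ y
  +-cancelˡ a {x} {y} e = begin
    x                       ≈⟨ +-cong (≈-sym ([p∸1]*a+a≈0 a)) ≈-refl ⟩
    (p ∸ 1) * a + a + x     ≡⟨ +-assoc ((p ∸ 1) * a) a x ⟩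
    (p ∸ 1) * a + (a + x)   ≈⟨ +-congˡ ((p ∸ 1) * a) e ⟩
    (p ∸ 1) * a + (a + y)   ≡⟨ +-assoc ((p ∸ 1) * a) a y ⟨
    (p ∸ 1) * a + a + y     ≈⟨ +-cong ([p∸1]*a+a≈0 a) ≈-refl ⟩
    y                       ∎
    where open ≈-Reasoning

  +≈0⇒[p∸1]*≈ : ∀ {x y} → x + y ≈ 0 → (p ∸ 1) * x ≈ y
  +≈0⇒[p∸1]*≈ {x} {y} e = begin
    (p ∸ 1) * x             ≡⟨ +-identityʳ ((p ∸ 1) * x) ⟨
    (p ∸ 1) * x + 0         ≈⟨ +-congˡ ((p ∸ 1) * x) (≈-sym e) ⟩
    (p ∸ 1) * x + (x + y)   ≡⟨ +-assoc ((p ∸ 1) * x) x y ⟨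
    (p ∸ 1) * x + x + y     ≈⟨ +-cong ([p∸1]*a+a≈0 x) ≈-refl ⟩
    y                       ∎
    where open ≈-Reasoning

  *-cancelˡ-unit : ∀ {u v x y} → v * u ≈ 1 → u * x ≈ u * y → x ≈ y
  *-cancelˡ-unit {u} {v} {x} {y} vu≈1 e = begin
    x             ≡⟨ *-identityˡ x ⟨
    1 * x         ≈⟨ *-cong (≈-sym vu≈1) ≈-refl ⟩
    v * u * x     ≡⟨ *-assoc v u x ⟩
    v * (u * x)   ≈⟨ *-congˡ v e ⟩
    v * (u * y)   ≡⟨ *-assoc v u y ⟨
    v * u * y     ≈⟨ *-cong vu≈1 ≈-refl ⟩
    1 * y         ≡⟨ *-identityˡ y ⟩
    y             ∎
    where open ≈-Reasoning

  *-inverse-unique : ∀ {a b c} → b < p → c < p → b * a ≈ 1 → c * a ≈ 1 → b ≡ c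
  *-inverse-unique {a} {b} {c} b<p c<p ba≈1 ca≈1 =
    ≈⇒≡ b<p c<p (*-cancelˡ-unit {u = a} {v = b} ba≈1 (begin
      a * b   ≡⟨ *-comm a b ⟩
      b * a   ≈⟨ ba≈1 ⟩
      1       ≈⟨ ≈-sym ca≈1 ⟩
      c * a   ≡⟨ *-comm c a ⟩
      a * c   ∎))
    where open ≈-Reasoning

  -- Matching on m and n avoids 0 ∸ 1: if one side is 0, then fall 0 (suc k) = 0 * _ and the other
  -- side has a first factor ≈ 0.
  fall-cong : ∀ {m n} k → m ≈ n → fall m k ≈ fall n k
  fall-cong                 zero    _ = ≈-refl
  fall-cong {zero}  {zero}  (suc k) _ = ≈-refl
  fall-cong {zero}  {suc n} (suc k) e = *-cong e ≈-refl
  fall-cong {suc m} {zero}  (suc k) e = *-cong e ≈-refl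
  fall-cong {suc m} {suc n} (suc k) e = *-cong e (fall-cong k (+-cancelˡ 1 e))

  fall-% : ∀ m k → fall m k ≈ fall (m % p) k
  fall-% m k = fall-cong k (≈-sym (m%p≈m m))

  suc-% : ∀ m → suc m % p ≡ suc (m % p) % p
  suc-% m = mod-≡ (+-congˡ 1 (≈-sym (m%p≈m m)))

  ∸-residue : ∀ c d m j → c + d ≡ p → d ≤ m → m % p ≡ j + d → m ∸ d ≈ j
  ∸-residue c d m j c+d≡p d≤m m%p≡j+d = begin
    m ∸ d             ≈⟨ ≈-sym (m+p≈m (m ∸ d)) ⟩
    m ∸ d + p         ≡⟨ cong (m ∸ d +_) (trans (sym c+d≡p) (+-comm c d)) ⟩
    m ∸ d + (d + c)   ≡⟨ trans (sym (+-assoc (m ∸ d) d c)) (cong (_+ c) (m∸n+n≡m d≤m)) ⟩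
    m + c             ≈⟨ +-cong (≈-sym (m%p≈m m)) ≈-refl ⟩
    m % p + c         ≡⟨ cong (_+ c) m%p≡j+d ⟩
    j + d + c         ≡⟨ trans (+-assoc j d c) (cong (j +_) (trans (+-comm d c) c+d≡p)) ⟩
    j + p             ≈⟨ m+p≈m j ⟩
    j                 ∎
    where open ≈-Reasoning

  -- E is the claimed value of H (suc d) n mod p as a function of n mod p. E-step is the recurrence
  -- at the residues m % p = j + d, where m ∸ d has residue j because c + d ≡ p; at the residues
  -- below d the coefficient fall m d vanishes mod p.
  module ResidueTable (c d : ℕ) (c+d≡p : c + d ≡ p) (E : ℕ → ℕ)
    (E-small : ∀ s → s ≤ d → E s ≡ 1)
    (E-step : ∀ j → j < c → E (j + d) + fall (j + d) d * E j ≈ E (suc (j + d) % p))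
    where

    open ≈-Reasoning

    E-recurrence : ∀ m → d ≤ m → E (m % p) + fall (m % p) d * E ((m ∸ d) % p) ≈ E (suc m % p)
    E-recurrence m d≤m with m % p <? d
    ... | yes m%p<d = begin
      E (m % p) + fall (m % p) d * E ((m ∸ d) % p)
        ≡⟨ cong (λ f → E (m % p) + f * E ((m ∸ d) % p)) (fall-< m%p<d) ⟩
      E (m % p) + 0
        ≡⟨ trans (+-identityʳ _) (E-small (m % p) (<⇒≤ m%p<d)) ⟩
      1
        ≡⟨ E-small (suc m % p) (subst (_≤ d) (sym (suc-% m)) (≤-trans (m%n≤m (suc (m % p)) p) m%p<d)) ⟨
      E (suc m % p)
        ∎
    ... | no m%p≮d = begin
      E (m % p) + fall (m % p) d * E ((m ∸ d) % p)
        ≡⟨ cong₂ (λ s r → E s + fall s d * E r) m%p≡j+d (trans (mod-≡ m∸d≈j) (m<n⇒m%n≡m j<p)) ⟩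
      E (j + d) + fall (j + d) d * E j
        ≈⟨ E-step j j<c ⟩
      E (suc (j + d) % p)
        ≡⟨ trans (cong (λ s → E (suc s % p)) (sym m%p≡j+d)) (cong E (sym (suc-% m))) ⟩
      E (suc m % p)
        ∎
      where
      j = m % p ∸ d
      m%p≡j+d : m % p ≡ j + d
      m%p≡j+d = sym (m∸n+n≡m (≮⇒≥ m%p≮d))
      j<c : j < c
      j<c = +-cancelʳ-< d j c (subst₂ _<_ m%p≡j+d (sym c+d≡p) (m%n<n m p))
      j<p : j < p
      j<p = ≤-trans j<c (subst (c ≤_) c+d≡p (m≤m+n c d))
      m∸d≈j : m ∸ d ≈ j
      m∸d≈j = ∸-residue c d m j c+d≡p d≤m m%p≡j+d

    H≈E : ∀ n → H (suc d) n ≈ E (n % p)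
    H≈E = <-rec (λ n → H (suc d) n ≈ E (n % p)) step
      where
      step : ∀ n → (∀ {m} → m < n → H (suc d) m ≈ E (m % p)) → H (suc d) n ≈ E (n % p)
      step n ih with n ≤? d
      ... | yes n≤d =
        ≡⇒≈ (trans (H-below d n (s≤s n≤d)) (sym (E-small (n % p) (≤-trans (m%n≤m n p) n≤d))))
      step zero    _  | no 0≰d = ⊥-elim (0≰d z≤n)
      step (suc m) ih | no m≰d = begin
        H (suc d) (suc m)
          ≡⟨ H-step d m d≤m ⟩
        H (suc d) m + fall m d * H (suc d) (m ∸ d)
          ≈⟨ +-cong (ih ≤-refl) (*-cong (fall-% m d) (ih (s≤s (m∸n≤m m d)))) ⟩
        E (m % p) + fall (m % p) d * E ((m ∸ d) % p)
          ≈⟨ E-recurrence m d≤m ⟩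
        E (suc m % p)
          ∎
        where
        d≤m : d ≤ m
        d≤m = s≤s⁻¹ (≰⇒> m≰d)

  Paired : List ℕ → Set
  Paired xs = ∀ {a} → a ∈ xs → ∃[ b ] b ∈ xs × b ≢ a × a * b ≈ 1

  Paired-resp-↭ : ∀ {xs ys} → xs ↭ ys → Paired xs → Paired ys
  Paired-resp-↭ σ paired a∈ys with paired (∈-resp-↭ (↭-sym σ) a∈ys)
  ... | b , b∈xs , b≢a , ab≈1 = b , ∈-resp-↭ σ b∈xs , b≢a , ab≈1

  Paired-drop : ∀ {a b zs} → Unique (a ∷ b ∷ zs) → All (_< p) (a ∷ b ∷ zs) →
                a * b ≈ 1 → Paired (a ∷ b ∷ zs) → Paired zs
  Paired-drop {a} {b} ((_ ∷ a∉zs) ∷ b∉zs ∷ _) (a<p ∷ b<p ∷ zs<p) ab≈1 paired {c} c∈zs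
    with paired (there (there c∈zs))
  ... | _ , here refl , _ , ca≈1 =
    ⊥-elim (All.lookup b∉zs c∈zs
      (*-inverse-unique b<p (All.lookup zs<p c∈zs) (≈-trans (≡⇒≈ (*-comm b a)) ab≈1) ca≈1))
  ... | _ , there (here refl) , _ , cb≈1 =
    ⊥-elim (All.lookup a∉zs c∈zs (*-inverse-unique a<p (All.lookup zs<p c∈zs) ab≈1 cb≈1))
  ... | c′ , there (there c′∈zs) , c′≢c , cc′≈1 = c′ , c′∈zs , c′≢c , cc′≈1

  product-paired : ∀ xs → Unique xs → All (_< p) xs → Paired xs → product xs ≈ 1
  product-paired xs = go (length xs) xs ≤-refl
    where
    go : ∀ n xs → length xs ≤ n → Unique xs → All (_< p) xs → Paired xs → product xs ≈ 1
    go _       []       _ _ _ _ = ≈-refl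
    go (suc n) (a ∷ ys) (s≤s |ys|≤n) u lt paired with paired (here refl)
    ... | b , here b≡a , b≢a , _ = ⊥-elim (b≢a b≡a)
    ... | b , there b∈ys , _ , ab≈1 with ∈-∃++ b∈ys
    ...   | us , vs , refl = begin
      product (a ∷ us ++ b ∷ vs)     ≡⟨ product-↭ σ ⟩
      a * (b * product (us ++ vs))   ≈⟨ *-congˡ a (*-congˡ b rest) ⟩
      a * (b * 1)                    ≡⟨ cong (a *_) (*-identityʳ b) ⟩
      a * b                          ≈⟨ ab≈1 ⟩
      1                              ∎
      where
      open ≈-Reasoning
      σ : a ∷ us ++ b ∷ vs ↭ a ∷ b ∷ us ++ vs
      σ = prep a (shift b us vs)
      u′ : Unique (a ∷ b ∷ us ++ vs)
      u′ = Unique-resp-↭ (↭⇒↭ₛ σ) u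
      lt′ : All (_< p) (a ∷ b ∷ us ++ vs)
      lt′ = All-resp-↭ σ lt
      shorter : length (us ++ vs) ≤ n
      shorter = ≤-trans (n≤1+n _) (subst (_≤ n) (↭-length (shift b us vs)) |ys|≤n)
      rest : product (us ++ vs) ≈ 1
      rest with u′ | lt′
      ... | _ ∷ _ ∷ u″ | _ ∷ _ ∷ lt″ =
        go n (us ++ vs) shorter u″ lt″ (Paired-drop u′ lt′ ab≈1 (Paired-resp-↭ σ paired))

module Wilson (k : ℕ) (p-prime : Prime (3 + k)) where

  open Modular (3 + k)

  inverse-exists : ∀ {a} → 0 < a → a < 3 + k → ∃[ b ] b < 3 + k × a * b ≈ 1
  inverse-exists {a} 0<a a<p with coprime-Bézout (prime⇒coprime p-prime {{>-nonZero 0<a}} a<p)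
  ... | Bézout.-+ x y eq = y % (3 + k) , m%n<n y (3 + k) , (begin
    a * (y % (3 + k))   ≈⟨ *-congˡ a (m%p≈m y) ⟩
    a * y               ≡⟨ *-comm a y ⟩
    y * a               ≡⟨ eq ⟨
    1 + x * (3 + k)     ≈⟨ +-congˡ 1 (n*p≈0 x) ⟩
    1                   ∎)
    where open ≈-Reasoning
  ... | Bézout.+- x y eq = (2 + k) * y % (3 + k) , m%n<n ((2 + k) * y) (3 + k) , (begin
    a * ((2 + k) * y % (3 + k))   ≈⟨ *-congˡ a (m%p≈m ((2 + k) * y)) ⟩
    a * ((2 + k) * y)             ≡⟨ reorder a (2 + k) y ⟩
    (2 + k) * (y * a)             ≈⟨ +≈0⇒[p∸1]*≈ (≈-trans (≡⇒≈ (trans (+-comm (y * a) 1) eq)) (n*p≈0 x)) ⟩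
    1                             ∎)
    where
    open ≈-Reasoning
    reorder : ∀ a u y → a * (u * y) ≡ u * (y * a)
    reorder = solve-∀

  square≈1⇒∣ : ∀ t → suc t * suc t ≈ 1 → 3 + k ∣ t ⊎ 3 + k ∣ 2 + t
  square≈1⇒∣ t sq≈1 = euclidsLemma t (2 + t) p-prime (≈0⇒∣ (+-cancelˡ 1 (begin
    1 + t * (2 + t)   ≡⟨ expand t ⟨
    suc t * suc t     ≈⟨ sq≈1 ⟩
    1                 ≡⟨ +-identityʳ 1 ⟨
    1 + 0             ∎)))
    where
    open ≈-Reasoning
    expand : ∀ t → suc t * suc t ≡ 1 + t * (2 + t)
    expand = solve-∀

  [p∸1]²≈1 : (2 + k) * (2 + k) ≈ 1
  [p∸1]²≈1 = begin
    (2 + k) * (2 + k)       ≡⟨ expand k ⟩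
    1 + (1 + k) * (3 + k)   ≈⟨ +-congˡ 1 (n*p≈0 (1 + k)) ⟩
    1                       ∎
    where
    open ≈-Reasoning
    expand : ∀ k → (2 + k) * (2 + k) ≡ 1 + (1 + k) * (3 + k)
    expand = solve-∀

  [2,p∸2] : List ℕ
  [2,p∸2] = map (2 +_) (downFrom k)

  ∈-[2,p∸2]⁺ : ∀ {i} → i < k → 2 + i ∈ [2,p∸2]
  ∈-[2,p∸2]⁺ i<k = ∈-map⁺ (2 +_) (∈-downFrom⁺ i<k)

  ∈-[2,p∸2]⁻ : ∀ {a} → a ∈ [2,p∸2] → ∃[ i ] i < k × a ≡ 2 + i
  ∈-[2,p∸2]⁻ a∈ with i , i∈ , refl ← ∈-map⁻ (2 +_) a∈ = i , ∈-downFrom⁻ i∈ , refl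

  2+i<p : ∀ {i} → i < k → 2 + i < 3 + k
  2+i<p i<k = s≤s (s≤s (s≤s (<⇒≤ i<k)))

  [2,p∸2]-unique : Unique [2,p∸2]
  [2,p∸2]-unique = Unique.map⁺ (+-cancelˡ-≡ 2 _ _) (Unique.downFrom⁺ k)

  [2,p∸2]<p : All (_< 3 + k) [2,p∸2]
  [2,p∸2]<p = All.tabulate λ a∈ → case ∈-[2,p∸2]⁻ a∈ of λ where
    (i , i<k , refl) → 2+i<p i<k

  inverse-in-[2,p∸2] : ∀ {i b} → i < k → b < 3 + k → (2 + i) * b ≈ 1 → b ∈ [2,p∸2] × b ≢ 2 + i
  inverse-in-[2,p∸2] {i} {zero} _ _ ab≈1 =
    ⊥-elim (0≢1+n (≈⇒≡ (s≤s z≤n) (s≤s (s≤s z≤n)) (≈-trans (≡⇒≈ (sym (*-zeroʳ (2 + i)))) ab≈1)))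
  inverse-in-[2,p∸2] {i} {suc zero} i<k _ ab≈1 =
    ⊥-elim (1+n≢0 (suc-injective (≈⇒≡ (2+i<p i<k) (s≤s (s≤s z≤n))
      (≈-trans (≡⇒≈ (sym (*-identityʳ (2 + i)))) ab≈1))))
  inverse-in-[2,p∸2] {i} {suc (suc j)} i<k b<p ab≈1 = ∈-[2,p∸2]⁺ j<k , b≢a
    where
    j≢k : j ≢ k
    j≢k refl =
      <-irrefl (+-cancelˡ-≡ 2 _ _ (*-inverse-unique {a = 2 + k} (2+i<p i<k) ≤-refl ab≈1 [p∸1]²≈1)) i<k
    j<k : j < k
    j<k = ≤∧≢⇒< (s≤s⁻¹ (s≤s⁻¹ (s≤s⁻¹ b<p))) j≢k
    b≢a : suc (suc j) ≢ 2 + i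
    b≢a refl with square≈1⇒∣ (suc i) ab≈1
    ... | inj₁ p∣1+i = ∤-between (s≤s z≤n) (s≤s (s≤s (<⇒≤ (≤-trans i<k (n≤1+n k))))) p∣1+i
    ... | inj₂ p∣3+i = ∤-between (s≤s z≤n) (s≤s (s≤s (s≤s i<k))) p∣3+i

  [2,p∸2]-paired : Paired [2,p∸2]
  [2,p∸2]-paired a∈ with ∈-[2,p∸2]⁻ a∈
  ... | i , i<k , refl with inverse-exists (s≤s z≤n) (2+i<p i<k)
  ...   | b , b<p , ab≈1 with inverse-in-[2,p∸2] i<k b<p ab≈1
  ...     | b∈ , b≢a = b , b∈ , b≢a , ab≈1

  wilson : (1 + k) ! ≈ 1
  wilson = subst (_≈ 1) (product-map-2+-downFrom k)
                 (product-paired [2,p∸2] [2,p∸2]-unique [2,p∸2]<p [2,p∸2]-paired)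

  wilson-classic : (2 + k) ! ≈ 2 + k
  wilson-classic = ≈-trans (*-congˡ (2 + k) wilson) (≡⇒≈ (*-identityʳ (2 + k)))
module Cycles[p∸1] (q : ℕ) (p-prime : Prime (3 + q)) where

  open Modular (3 + q)
  open Wilson q p-prime using (wilson; wilson-classic)

  residue : ℕ → ℕ
  residue s with s ≟ 2 + q
  ... | yes _ = 2
  ... | no _  = 1

  residue-top : ∀ {s} → s ≡ 2 + q → residue s ≡ 2
  residue-top {s} s≡ with s ≟ 2 + q
  ... | yes _ = refl
  ... | no s≢ = ⊥-elim (s≢ s≡)

  residue-rest : ∀ {s} → s ≢ 2 + q → residue s ≡ 1
  residue-rest {s} s≢ with s ≟ 2 + q
  ... | yes s≡ = ⊥-elim (s≢ s≡)
  ... | no _   = refl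

  residue-below : ∀ {s} → s < 2 + q → residue s ≡ 1
  residue-below s< = residue-rest (<⇒≢ s<)

  residue-between : ∀ s → 0 < residue s × residue s < 3 + q
  residue-between s with s ≟ 2 + q
  ... | yes _ = s≤s z≤n , s≤s (s≤s (s≤s z≤n))
  ... | no _  = s≤s z≤n , s≤s (s≤s z≤n)

  H≈residue : ∀ n → H (2 + q) n ≈ residue (n % (3 + q))
  H≈residue = ResidueTable.H≈E 2 (1 + q) refl residue (λ _ s≤1+q → residue-below (s≤s s≤1+q)) step
    where
    open ≈-Reasoning
    step : ∀ j → j < 2 →
           residue (j + (1 + q)) + fall (j + (1 + q)) (1 + q) * residue j
             ≈ residue (suc (j + (1 + q)) % (3 + q))
    step zero _ = begin
      residue (1 + q) + fall (1 + q) (1 + q) * residue 0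
        ≡⟨ cong₂ (λ x y → x + fall (1 + q) (1 + q) * y) (residue-below (n<1+n _)) (residue-below (s≤s z≤n)) ⟩
      1 + fall (1 + q) (1 + q) * 1
        ≡⟨ cong (1 +_) (fall[k+n]n*k!≡[k+n]! 0 (1 + q)) ⟩
      1 + (1 + q) !
        ≈⟨ +-congˡ 1 wilson ⟩
      2
        ≡⟨ trans (cong residue (m<n⇒m%n≡m (n<1+n (2 + q)))) (residue-top refl) ⟨
      residue ((2 + q) % (3 + q))
        ∎
    step (suc zero) _ = begin
      residue (2 + q) + fall (2 + q) (1 + q) * residue 1
        ≡⟨ cong₂ (λ x y → x + fall (2 + q) (1 + q) * y) (residue-top refl) (residue-below (s≤s (s≤s z≤n))) ⟩
      2 + fall (2 + q) (1 + q) * 1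
        ≡⟨ cong (2 +_) (fall[k+n]n*k!≡[k+n]! 1 (1 + q)) ⟩
      2 + (2 + q) !
        ≈⟨ +-congˡ 2 wilson-classic ⟩
      1 + (3 + q)
        ≈⟨ m+p≈m 1 ⟩
      1
        ≡⟨ trans (cong residue (n%n≡0 (3 + q))) (residue-below (s≤s z≤n)) ⟨
      residue ((3 + q) % (3 + q))
        ∎
    step (suc (suc _)) (s≤s (s≤s ()))

  H-mod-p : (n : ℕ) →
      (n % (3 + q) ≢ 2 + q → H (2 + q) n % (3 + q) ≡ 1 % (3 + q))
    × (n % (3 + q) ≡ 2 + q → H (2 + q) n % (3 + q) ≡ 2 % (3 + q))
    × ¬ (3 + q ∣ H (2 + q) n)
  H-mod-p n = (λ s≢ → mod-≡ (H≈ (residue-rest s≢)))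
            , (λ s≡ → mod-≡ (H≈ (residue-top s≡)))
            , ≈-between⇒∤ (H≈residue n) (residue-between (n % (3 + q)))
    where
    H≈ : ∀ {v} → residue (n % (3 + q)) ≡ v → H (2 + q) n ≈ v
    H≈ e = ≈-trans (H≈residue n) (≡⇒≈ e)

module Cycles[p∸2] (r : ℕ) (p-prime : Prime (5 + r)) where

  open Modular (5 + r)
  open Wilson (2 + r) p-prime using (wilson; wilson-classic)

  t : ℕ
  t = (5 + r) / 2

  p≡1+t*2 : 5 + r ≡ 1 + t * 2
  p≡1+t*2 with (5 + r) % 2 in p%2≡ | m%n<n (5 + r) 2 | m≡m%n+[m/n]*n (5 + r) 2
  ... | 1           | _            | p≡ = p≡
  ... | suc (suc _) | s≤s (s≤s ()) | _
  ... | 0           | _            | _ with prime⇒irreducible p-prime (m%n≡0⇒n∣m (5 + r) 2 p%2≡)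
  ...   | inj₁ ()
  ...   | inj₂ ()

  t<p∸2 : t < 3 + r
  t<p∸2 = m<n*o⇒m/o<n {5 + r} {3 + r} {2} (+-monoʳ-≤ 6 (m≤m*n r 2))

  h : ℕ
  h = (5 + r + 1) / 2

  p+1≡[1+t]*2 : 5 + r + 1 ≡ suc t * 2
  p+1≡[1+t]*2 = trans (cong (_+ 1) p≡1+t*2) (+-comm (1 + t * 2) 1)

  h≡1+t : h ≡ suc t
  h≡1+t = trans (cong (_/ 2) p+1≡[1+t]*2) (m*n/n≡m (suc t) 2)

  2*h≡p+1 : 2 * h ≡ 5 + r + 1
  2*h≡p+1 = trans (cong (2 *_) h≡1+t) (trans (*-comm 2 (suc t)) (sym p+1≡[1+t]*2))

  [p+3]/2≡1+h : (5 + r + 3) / 2 ≡ suc h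
  [p+3]/2≡1+h = begin
    (5 + r + 3) / 2       ≡⟨ cong (_/ 2) p+3≡[2+t]*2 ⟩
    suc (suc t) * 2 / 2   ≡⟨ m*n/n≡m (suc (suc t)) 2 ⟩
    suc (suc t)           ≡⟨ cong suc h≡1+t ⟨
    suc h                 ∎
    where
    open ≡-Reasoning
    p+3≡[2+t]*2 : 5 + r + 3 ≡ suc (suc t) * 2
    p+3≡[2+t]*2 = trans (sym (+-assoc (5 + r) 1 2))
                        (trans (cong (_+ 2) p+1≡[1+t]*2) (+-comm (suc t * 2) 2))

  1+h<p : suc h < 5 + r
  1+h<p = subst (_< 5 + r) (cong suc (sym h≡1+t)) (s≤s (s≤s t<p∸2))

  h*2≈1 : h * 2 ≈ 1
  h*2≈1 = begin
    h * 2         ≡⟨ trans (*-comm h 2) 2*h≡p+1 ⟩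
    5 + r + 1     ≡⟨ +-comm (5 + r) 1 ⟩
    1 + (5 + r)   ≈⟨ m+p≈m 1 ⟩
    1             ∎
    where open ≈-Reasoning

  halve : ∀ {x y} → 2 * x ≈ 2 * y → x ≈ y
  halve = *-cancelˡ-unit {u = 2} {v = h} h*2≈1

  1+[p∸3]!≈h : 1 + (2 + r) ! ≈ h
  1+[p∸3]!≈h = halve (begin
    2 * (1 + x)   ≈⟨ +-cancelˡ 1 (begin
        1 + 2 * (1 + x)             ≈⟨ +-cong (≈-sym wilson) ≈-refl ⟩
        (3 + r) * x + 2 * (1 + x)   ≡⟨ expand r x ⟩
        2 + x * (5 + r)             ≈⟨ +-congˡ 2 (n*p≈0 x) ⟩
        2                           ∎) ⟩
    1             ≈⟨ ≈-sym h*2≈1 ⟩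
    h * 2         ≡⟨ *-comm h 2 ⟩
    2 * h         ∎)
    where
    open ≈-Reasoning
    x = (2 + r) !
    expand : ∀ r x → (3 + r) * x + 2 * (1 + x) ≡ 2 + x * (5 + r)
    expand = solve-∀

  1+h+[p∸1]!/2≈1 : suc h + fall (4 + r) (2 + r) ≈ 1
  1+h+[p∸1]!/2≈1 = +-congˡ 1 (halve (begin
    2 * (h + F)             ≡⟨ *-distribˡ-+ 2 h F ⟩
    2 * h + 2 * F           ≡⟨ cong₂ _+_ 2*h≡p+1 (trans (*-comm 2 F) (fall[k+n]n*k!≡[k+n]! 2 (2 + r))) ⟩
    5 + r + 1 + (4 + r) !   ≈⟨ +-congˡ (5 + r + 1) wilson-classic ⟩
    5 + r + 1 + (4 + r)     ≡⟨ double r ⟩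
    2 * (5 + r)             ≈⟨ n*p≈0 2 ⟩
    0                       ∎))
    where
    open ≈-Reasoning
    F = fall (4 + r) (2 + r)
    double : ∀ r → 5 + r + 1 + (4 + r) ≡ 2 * (5 + r)
    double = solve-∀

  residue : ℕ → ℕ
  residue s with s ≟ 4 + r | s ≟ 3 + r
  ... | yes _ | _     = suc h
  ... | no _  | yes _ = h
  ... | no _  | no _  = 1

  residue-top : ∀ {s} → s ≡ 4 + r → residue s ≡ suc h
  residue-top {s} s≡ with s ≟ 4 + r
  ... | yes _ = refl
  ... | no s≢ = ⊥-elim (s≢ s≡)

  residue-mid : ∀ {s} → s ≡ 3 + r → residue s ≡ h
  residue-mid {s} s≡ with s ≟ 4 + r | s ≟ 3 + r
  ... | no _    | yes _ = refl
  ... | no _    | no s≢ = ⊥-elim (s≢ s≡)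
  ... | yes s≡′ | _     = ⊥-elim (1+n≢n (trans (sym s≡′) s≡))

  residue-rest : ∀ {s} → s ≢ 4 + r → s ≢ 3 + r → residue s ≡ 1
  residue-rest {s} s≢₁ s≢₂ with s ≟ 4 + r | s ≟ 3 + r
  ... | no _   | no _   = refl
  ... | yes s≡ | _      = ⊥-elim (s≢₁ s≡)
  ... | no _   | yes s≡ = ⊥-elim (s≢₂ s≡)

  residue-below : ∀ {s} → s < 3 + r → residue s ≡ 1
  residue-below s< = residue-rest (<⇒≢ (<-trans s< (n<1+n _))) (<⇒≢ s<)

  residue-between : ∀ s → 0 < residue s × residue s < 5 + r
  residue-between s with s ≟ 4 + r | s ≟ 3 + r
  ... | yes _ | _     = s≤s z≤n , 1+h<p
  ... | no _  | yes _ = subst (0 <_) (sym h≡1+t) (s≤s z≤n) , <-trans (n<1+n h) 1+h<p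
  ... | no _  | no _  = s≤s z≤n , s≤s (s≤s z≤n)

  H≈residue : ∀ n → H (3 + r) n ≈ residue (n % (5 + r))
  H≈residue = ResidueTable.H≈E 3 (2 + r) refl residue (λ _ s≤2+r → residue-below (s≤s s≤2+r)) step
    where
    open ≈-Reasoning
    step : ∀ j → j < 3 →
           residue (j + (2 + r)) + fall (j + (2 + r)) (2 + r) * residue j
             ≈ residue (suc (j + (2 + r)) % (5 + r))
    step zero _ = begin
      residue (2 + r) + fall (2 + r) (2 + r) * residue 0
        ≡⟨ cong₂ (λ x y → x + fall (2 + r) (2 + r) * y) (residue-below (n<1+n _)) (residue-below (s≤s z≤n)) ⟩
      1 + fall (2 + r) (2 + r) * 1
        ≡⟨ cong (1 +_) (fall[k+n]n*k!≡[k+n]! 0 (2 + r)) ⟩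
      1 + (2 + r) !
        ≈⟨ 1+[p∸3]!≈h ⟩
      h
        ≡⟨ trans (cong residue (m<n⇒m%n≡m (<-trans (n<1+n (3 + r)) (n<1+n (4 + r))))) (residue-mid refl) ⟨
      residue ((3 + r) % (5 + r))
        ∎
    step (suc zero) _ = begin
      residue (3 + r) + fall (3 + r) (2 + r) * residue 1
        ≡⟨ cong₂ (λ x y → x + fall (3 + r) (2 + r) * y) (residue-mid refl) (residue-below (s≤s (s≤s z≤n))) ⟩
      h + fall (3 + r) (2 + r) * 1
        ≡⟨ cong (h +_) (fall[k+n]n*k!≡[k+n]! 1 (2 + r)) ⟩
      h + (3 + r) !
        ≈⟨ +-congˡ h wilson ⟩
      h + 1
        ≡⟨ +-comm h 1 ⟩
      suc h
        ≡⟨ trans (cong residue (m<n⇒m%n≡m (n<1+n (4 + r)))) (residue-top refl) ⟨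
      residue ((4 + r) % (5 + r))
        ∎
    step (suc (suc zero)) _ = begin
      residue (4 + r) + fall (4 + r) (2 + r) * residue 2
        ≡⟨ cong₂ (λ x y → x + fall (4 + r) (2 + r) * y) (residue-top refl) (residue-below (s≤s (s≤s (s≤s z≤n)))) ⟩
      suc h + fall (4 + r) (2 + r) * 1
        ≡⟨ cong (suc h +_) (*-identityʳ _) ⟩
      suc h + fall (4 + r) (2 + r)
        ≈⟨ 1+h+[p∸1]!/2≈1 ⟩
      1
        ≡⟨ trans (cong residue (n%n≡0 (5 + r))) (residue-below (s≤s z≤n)) ⟨
      residue ((5 + r) % (5 + r))
        ∎
    step (suc (suc (suc _))) (s≤s (s≤s (s≤s ())))

  H-mod-p : (n : ℕ) →
      (n % (5 + r) ≢ 4 + r → n % (5 + r) ≢ 3 + r → H (3 + r) n % (5 + r) ≡ 1 % (5 + r))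
    × (n % (5 + r) ≡ 3 + r → H (3 + r) n % (5 + r) ≡ ((5 + r + 1) / 2) % (5 + r))
    × (n % (5 + r) ≡ 4 + r → H (3 + r) n % (5 + r) ≡ ((5 + r + 3) / 2) % (5 + r))
    × ¬ (5 + r ∣ H (3 + r) n)
  H-mod-p n = (λ s≢₁ s≢₂ → mod-≡ (H≈ (residue-rest s≢₁ s≢₂)))
            , (λ s≡ → mod-≡ (H≈ (residue-mid s≡)))
            , (λ s≡ → mod-≡ (H≈ (trans (residue-top s≡) (sym [p+3]/2≡1+h))))
            , ≈-between⇒∤ (H≈residue n) (residue-between (n % (5 + r)))
    where
    H≈ : ∀ {v} → residue (n % (5 + r)) ≡ v → H (3 + r) n ≈ v
    H≈ e = ≈-trans (H≈residue n) (≡⇒≈ e)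

mainTheorem18 : (p : ℕ) → .{{_ : NonZero p}} → Prime p → p ≢ 2 →
    ((n : ℕ) →
       (n % p ≢ p ∸ 1 → H (p ∸ 1) n % p ≡ 1 % p)
     × (n % p ≡ p ∸ 1 → H (p ∸ 1) n % p ≡ 2 % p)
     × ¬ (p ∣ H (p ∸ 1) n))
    × (p > 3 → (n : ℕ) →
       (n % p ≢ p ∸ 1 → n % p ≢ p ∸ 2 → H (p ∸ 2) n % p ≡ 1 % p)
     × (n % p ≡ p ∸ 2 → H (p ∸ 2) n % p ≡ ((p + 1) / 2) % p)
     × (n % p ≡ p ∸ 1 → H (p ∸ 2) n % p ≡ ((p + 3) / 2) % p)
     × ¬ (p ∣ H (p ∸ 2) n))
mainTheorem18 0 p-prime _ = ⊥-elim (¬prime[0] p-prime)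
mainTheorem18 1 p-prime _ = ⊥-elim (¬prime[1] p-prime)
mainTheorem18 2 _ p≢2 = ⊥-elim (p≢2 refl)
mainTheorem18 3 p-prime _ = Cycles[p∸1].H-mod-p 0 p-prime , λ { (s≤s (s≤s (s≤s ()))) }
mainTheorem18 4 p-prime _ = ⊥-elim (composite⇒¬prime composite[4] p-prime)
mainTheorem18 (suc (suc (suc (suc (suc r))))) p-prime _ =
  Cycles[p∸1].H-mod-p (2 + r) p-prime , λ _ → Cycles[p∸2].H-mod-p r p-prime
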